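{- Let $G$ be a graph with diameter $2$ and minimum degree at least $3$. Then $G$ contains a cycle of length $4$ or a cycle of length $8$.
   Context: Graphs are simple (no loops or multiple edges). The diameter of a connected graph is the maximum, over all pairs of vertices, of the length of a shortest path between them. A cycle of length $k$ means $k$ distinct vertices $u_1,\dots,u_k$ with $u_iu_{i+1}$ an edge for each $i$ (indices mod $k$); a graph contains such a cycle if it has such a (not necessarily induced) subgraph. -}

module Defs where

open import Data.Nat using (ℕ; zero; suc; _≤_; _<_)
open import Data.Fin using (Fin)
open import Data.Fin.Subset using (Subset; ∣_∣)
open import Data.Vec using (tabulate)
open import Data.Bool using (Bool)
open import Data.Product using (Σ; _×_; ∃-syntax)
open import Relation.Nullary using (¬_; Dec; does)
open import Relation.Binary.PropositionalEquality using (_≡_; _≢_)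
open import Function.Definitions using (Injective)

record Graph (n : ℕ) : Set₁ where
  field
    Adj    : Fin n → Fin n → Set
    adj?   : ∀ u v → Dec (Adj u v)
    sym    : ∀ {u v} → Adj u v → Adj v u
    irrefl : ∀ {u} → ¬ Adj u u
open Graph public

neighbourhood : ∀ {n} (G : Graph n) → Fin n → Subset n
neighbourhood G v = tabulate (λ u → does (adj? G v u))

degree : ∀ {n} (G : Graph n) → Fin n → ℕ
degree G v = ∣ neighbourhood G v ∣

MinDegreeAtLeast : ∀ {n} → Graph n → ℕ → Set
MinDegreeAtLeast {n} G d = ∀ (v : Fin n) → d ≤ degree G v

data Walk {n} (G : Graph n) : Fin n → Fin n → ℕ → Set where
  here : ∀ {u} → Walk G u u zero
  step : ∀ {u w v k} → Adj G u w → Walk G w v k → Walk G u v (suc k)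

Dist : ∀ {n} → Graph n → Fin n → Fin n → ℕ → Set
Dist G u v d = Walk G u v d × (∀ k → k < d → ¬ Walk G u v k)

HasDiameter : ∀ {n} → Graph n → ℕ → Set
HasDiameter {n} G d =
  (∀ (u v : Fin n) → ∃[ e ] (Dist G u v e × e ≤ d)) ×
  (∃[ u ] ∃[ v ] Dist G u v d)

-- G contains a cycle of length k: k distinct vertices u₀ … u_{k-1}
-- with u_i u_{i+1} adjacent (indices mod k).
-- Encoded as an injective map f : Fin k → Fin n with f i ~ f (i+1 mod k).
-- (Meaningful for k ≥ 3; we only use k = 4 and k = 8.)
sucMod : ∀ {k} → Fin k → Fin k
sucMod {suc k} i = Data.Fin.fromℕ< {Data.Nat._%_ (suc (Data.Fin.toℕ i)) (suc k)}
                     (Data.Nat.DivMod.m%n<n (suc (Data.Fin.toℕ i)) (suc k))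
  where import Data.Nat.DivMod

HasCycle : ∀ {n} → Graph n → ℕ → Set
HasCycle {n} G k =
  Σ (Fin k → Fin n) λ f → Injective _≡_ _≡_ f × (∀ i → Adj G (f i) (f (sucMod i)))

-- Without a 4-cycle, two distinct vertices have at most one common neighbour. Call an
-- edge vb spread if v has two neighbours c, d outside N[b] and b has two neighbours
-- b₁, b₂ outside N[v]. The edges cb₁ and db₂ would close 4-cycles, so by diameter 2
-- there are common neighbours y of c, b₁ and z of d, b₂, and v c y b₁ b b₂ z d is an
-- 8-cycle. Minimum degree 3 yields a spread edge: a triangle-free edge is spread, and
-- an edge vx lying on its unique triangle vxw is spread unless an end, say v, has degree
-- exactly 3, in which case the edge from v to its third neighbour is triangle-free.
module Submission where

open import Data.Bool using (true)
open import Data.Empty using (⊥-elim)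
open import Data.Fin using (Fin; zero; suc; toℕ; fromℕ; inject₁; _≟_)
open import Data.Fin.Properties
  using (any?; toℕ-injective; toℕ-fromℕ<; toℕ-fromℕ; toℕ-inject₁; toℕ<n)
open import Data.Fin.Subset using (Subset; inside; outside; ∣_∣; _∈_; _∉_; _∪_; ⁅_⁆; _⊆_)
open import Data.Fin.Subset.Properties using (_∈?_; p⊆q⇒∣p∣≤∣q∣; x∈p∪q⁺; x∈⁅x⁆; ∣⁅x⁆∣≡1)
open import Data.Nat using (ℕ; zero; suc; _+_; _≤_; _<_; s≤s; z≤n)
open import Data.Nat.DivMod using (_%_; m<n⇒m%n≡m; n%n≡0)
open import Data.Nat.Properties using (≤-trans; ≤-reflexive; <⇒≱; n≤1+n; +-suc; +-monoʳ-≤)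
open import Data.Product using (∃; ∃₂; _×_; _,_)
open import Data.Sum using (_⊎_; inj₁; inj₂)
open import Data.Vec using (Vec; []; _∷_; lookup; head; last)
open import Data.Vec.Properties using (lookup∘tabulate; []=⇒lookup)
open import Data.Vec.Relation.Unary.All using ([]; _∷_)
open import Data.Vec.Relation.Unary.AllPairs using ([]; _∷_)
open import Data.Vec.Relation.Unary.Linked using (Linked; [-]; _∷_)
open import Data.Vec.Relation.Unary.Unique.Propositional using (Unique)
open import Data.Vec.Relation.Unary.Unique.Propositional.Properties using (lookup-injective)
open import Relation.Binary.PropositionalEquality as ≡
  using (_≡_; _≢_; refl; cong₂; subst; subst₂; ≢-sym; module ≡-Reasoning)
open import Relation.Nullary using (¬_; yes; no; does; proof)
open import Relation.Nullary.Reflects using (Reflects; invert)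
open import Relation.Nullary.Decidable using (¬?; _×-dec_; decidable-stable)

open import Defs

∣p∪q∣≤∣p∣+∣q∣ : ∀ {n} (p q : Subset n) → ∣ p ∪ q ∣ ≤ ∣ p ∣ + ∣ q ∣
∣p∪q∣≤∣p∣+∣q∣ []            []            = z≤n
∣p∪q∣≤∣p∣+∣q∣ (outside ∷ p) (outside ∷ q) = ∣p∪q∣≤∣p∣+∣q∣ p q
∣p∪q∣≤∣p∣+∣q∣ (inside  ∷ p) (outside ∷ q) = s≤s (∣p∪q∣≤∣p∣+∣q∣ p q)
∣p∪q∣≤∣p∣+∣q∣ (outside ∷ p) (inside  ∷ q) =
  ≤-trans (s≤s (∣p∪q∣≤∣p∣+∣q∣ p q)) (≤-reflexive (≡.sym (+-suc ∣ p ∣ ∣ q ∣)))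
∣p∪q∣≤∣p∣+∣q∣ (inside  ∷ p) (inside  ∷ q) =
  s≤s (≤-trans (∣p∪q∣≤∣p∣+∣q∣ p q) (+-monoʳ-≤ ∣ p ∣ (n≤1+n ∣ q ∣)))

∣q∣<∣p∣⇒∃x∈p∧x∉q : ∀ {n} {p q : Subset n} → ∣ q ∣ < ∣ p ∣ → ∃ λ x → x ∈ p × x ∉ q
∣q∣<∣p∣⇒∃x∈p∧x∉q {p = p} {q} ∣q∣<∣p∣ with any? (λ x → x ∈? p ×-dec ¬? (x ∈? q))
... | yes witness = witness
... | no  none    = ⊥-elim (<⇒≱ ∣q∣<∣p∣ (p⊆q⇒∣p∣≤∣q∣ p⊆q))
  where
  p⊆q : p ⊆ q
  p⊆q {x} x∈p = decidable-stable (x ∈? q) (λ x∉q → none (x , x∈p , x∉q))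

sucMod-inject₁ : ∀ {k} (j : Fin k) → sucMod (inject₁ j) ≡ suc j
sucMod-inject₁ {k} j = toℕ-injective (begin
  toℕ (sucMod (inject₁ j))       ≡⟨ toℕ-fromℕ< _ ⟩
  suc (toℕ (inject₁ j)) % suc k  ≡⟨ ≡.cong (λ m → suc m % suc k) (toℕ-inject₁ j) ⟩
  suc (toℕ j) % suc k            ≡⟨ m<n⇒m%n≡m (s≤s (toℕ<n j)) ⟩
  suc (toℕ j)                    ∎)
  where open ≡-Reasoning

sucMod-fromℕ : ∀ k → sucMod (fromℕ k) ≡ zero
sucMod-fromℕ k = toℕ-injective (begin
  toℕ (sucMod (fromℕ k))       ≡⟨ toℕ-fromℕ< _ ⟩
  suc (toℕ (fromℕ k)) % suc k  ≡⟨ ≡.cong (λ m → suc m % suc k) (toℕ-fromℕ k) ⟩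
  suc k % suc k                ≡⟨ n%n≡0 (suc k) ⟩
  0                            ∎)
  where open ≡-Reasoning

data LastOrInject₁ : ∀ {k} → Fin (suc k) → Set where
  is-last    : ∀ {k} → LastOrInject₁ (fromℕ k)
  is-inject₁ : ∀ {k} (j : Fin k) → LastOrInject₁ (inject₁ j)

lastOrInject₁ : ∀ {k} (i : Fin (suc k)) → LastOrInject₁ i
lastOrInject₁ {zero}  zero    = is-last
lastOrInject₁ {suc k} zero    = is-inject₁ zero
lastOrInject₁ {suc k} (suc i) with lastOrInject₁ i
... | is-last      = is-last
... | is-inject₁ j = is-inject₁ (suc j)

module _ {a r} {A : Set a} {R : A → A → Set r} where

  lookup-fromℕ : ∀ {k} (xs : Vec A (suc k)) → lookup xs (fromℕ k) ≡ last xs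
  lookup-fromℕ (x ∷ [])     = refl
  lookup-fromℕ (x ∷ y ∷ xs) = lookup-fromℕ (y ∷ xs)

  lookup-consecutive : ∀ {k} {xs : Vec A (suc k)} → Linked R xs →
                       ∀ j → R (lookup xs (inject₁ j)) (lookup xs (suc j))
  lookup-consecutive {xs = _ ∷ _ ∷ _} (Rxy ∷ _)   zero    = Rxy
  lookup-consecutive {xs = _ ∷ _ ∷ _} (_   ∷ Rxs) (suc j) = lookup-consecutive Rxs j

  lookup-sucMod : ∀ {k} {xs : Vec A (suc k)} → Linked R xs → R (last xs) (head xs) →
                  ∀ i → R (lookup xs i) (lookup xs (sucMod i))
  lookup-sucMod {k} {xs@(_ ∷ _)} linked closing i with lastOrInject₁ i
  ... | is-last      =
    subst₂ R (≡.sym (lookup-fromℕ xs)) (≡.cong (lookup xs) (≡.sym (sucMod-fromℕ k))) closing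
  ... | is-inject₁ j =
    subst (R _) (≡.cong (lookup xs) (≡.sym (sucMod-inject₁ j))) (lookup-consecutive linked j)

module _ {n} (G : Graph n) where

  infix 4 _~_
  _~_ : Fin n → Fin n → Set
  _~_ = Adj G

  ~⇒≢ : ∀ {u v} → u ~ v → u ≢ v
  ~⇒≢ u~u refl = irrefl G u~u

  ~∧≁⇒≢ : ∀ {w u u'} → w ~ u → ¬ w ~ u' → u ≢ u'
  ~∧≁⇒≢ w~u w≁u refl = w≁u w~u

  closedWalk⇒cycle : ∀ {k} (xs : Vec (Fin n) (suc k)) → Unique xs → Linked _~_ xs →
                     last xs ~ head xs → HasCycle G (suc k)
  closedWalk⇒cycle xs distinct linked closing =
    lookup xs , (λ {i} {j} → lookup-injective distinct i j) , lookup-sucMod linked closing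

  ∈-neighbourhood⁻ : ∀ {v x} → x ∈ neighbourhood G v → v ~ x
  ∈-neighbourhood⁻ {v} {x} x∈N =
    invert (subst (Reflects (v ~ x)) does≡true (proof (adj? G v x)))
    where
    open ≡-Reasoning
    does≡true : does (adj? G v x) ≡ true
    does≡true = begin
      does (adj? G v x)             ≡⟨ lookup∘tabulate (λ u → does (adj? G v u)) x ⟨
      lookup (neighbourhood G v) x  ≡⟨ []=⇒lookup x∈N ⟩
      true                          ∎

  neighbour-∉ : ∀ {v} {s : Subset n} → ∣ s ∣ < degree G v → ∃ λ u → v ~ u × u ∉ s
  neighbour-∉ ∣s∣<deg with ∣q∣<∣p∣⇒∃x∈p∧x∉q ∣s∣<deg
  ... | u , u∈N , u∉s = u , ∈-neighbourhood⁻ u∈N , u∉s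

  neighbour-avoiding : MinDegreeAtLeast G 3 → ∀ v a a' → ∃ λ u → v ~ u × u ≢ a × u ≢ a'
  neighbour-avoiding δ≥3 v a a'
    with neighbour-∉ {v} {⁅ a ⁆ ∪ ⁅ a' ⁆} (≤-trans (s≤s ∣s∣≤2) (δ≥3 v))
    where
    ∣s∣≤2 : ∣ ⁅ a ⁆ ∪ ⁅ a' ⁆ ∣ ≤ 2
    ∣s∣≤2 = subst (∣ ⁅ a ⁆ ∪ ⁅ a' ⁆ ∣ ≤_) (cong₂ _+_ (∣⁅x⁆∣≡1 a) (∣⁅x⁆∣≡1 a'))
                  (∣p∪q∣≤∣p∣+∣q∣ ⁅ a ⁆ ⁅ a' ⁆)
  ... | u , v~u , u∉s = u , v~u , (λ { refl → u∉s (x∈p∪q⁺ (inj₁ (x∈⁅x⁆ a))) })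
                                , (λ { refl → u∉s (x∈p∪q⁺ (inj₂ (x∈⁅x⁆ a'))) })

  CommonNeighbour : Fin n → Fin n → Fin n → Set
  CommonNeighbour u v w = u ~ w × w ~ v

  UniqueCommonNeighbours : Set
  UniqueCommonNeighbours =
    ∀ {u v w w'} → u ≢ v → CommonNeighbour u v w → CommonNeighbour u v w' → w ≡ w'

  cycle4⊎uniqueCommonNeighbours : HasCycle G 4 ⊎ UniqueCommonNeighbours
  cycle4⊎uniqueCommonNeighbours with
    any? (λ u → any? λ v → any? λ w → any? λ w' → ¬? (u ≟ v) ×-dec ¬? (w ≟ w') ×-dec
      (adj? G u w ×-dec adj? G w v) ×-dec (adj? G u w' ×-dec adj? G w' v))
  ... | yes (u , v , w , w' , u≢v , w≢w' , (u~w , w~v) , (u~w' , w'~v)) =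
    inj₁ (closedWalk⇒cycle (u ∷ w ∷ v ∷ w' ∷ []) distinct
                           (u~w ∷ w~v ∷ sym G w'~v ∷ [-]) (sym G u~w'))
    where
    distinct : Unique (u ∷ w ∷ v ∷ w' ∷ [])
    distinct = (~⇒≢ u~w ∷ u≢v ∷ ~⇒≢ u~w' ∷ [])
             ∷ (~⇒≢ w~v ∷ w≢w' ∷ [])
             ∷ (≢-sym (~⇒≢ w'~v) ∷ [])
             ∷ [] ∷ []
  ... | no none = inj₂ λ {u} {v} {w} {w'} u≢v cn cn' →
    decidable-stable (w ≟ w') (λ w≢w' → none (u , v , w , w' , u≢v , w≢w' , cn , cn'))

  WithinDistanceTwo : Fin n → Fin n → Set
  WithinDistanceTwo u v = u ≡ v ⊎ u ~ v ⊎ ∃ (CommonNeighbour u v)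

  walk≤2⇒withinDistanceTwo : ∀ {u v e} → Walk G u v e → e ≤ 2 → WithinDistanceTwo u v
  walk≤2⇒withinDistanceTwo here                         _ = inj₁ refl
  walk≤2⇒withinDistanceTwo (step u~v here)              _ = inj₂ (inj₁ u~v)
  walk≤2⇒withinDistanceTwo (step u~w (step w~v here))   _ = inj₂ (inj₂ (_ , u~w , w~v))
  walk≤2⇒withinDistanceTwo (step _ (step _ (step _ _))) (s≤s (s≤s ()))

  diameter2⇒withinDistanceTwo : HasDiameter G 2 → ∀ u v → WithinDistanceTwo u v
  diameter2⇒withinDistanceTwo (within , _) u v with within u v
  ... | _ , (walk , _) , e≤2 = walk≤2⇒withinDistanceTwo walk e≤2

  PrivateNeighbour : Fin n → Fin n → Fin n → Set
  PrivateNeighbour v b u = v ~ u × u ≢ b × ¬ b ~ u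

  TwoPrivateNeighbours : Fin n → Fin n → Set
  TwoPrivateNeighbours v b = ∃₂ λ c d → c ≢ d × PrivateNeighbour v b c × PrivateNeighbour v b d

  SpreadEdge : Fin n → Fin n → Set
  SpreadEdge v b = v ~ b × TwoPrivateNeighbours v b × TwoPrivateNeighbours b v

  TriangleFreeEdge : Fin n → Fin n → Set
  TriangleFreeEdge v b = v ~ b × ¬ ∃ (CommonNeighbour v b)

  module _ (δ≥3 : MinDegreeAtLeast G 3) where

    noCommonNeighbour⇒twoPrivateNeighbours : ∀ {v b} → ¬ ∃ (CommonNeighbour v b) →
                                           TwoPrivateNeighbours v b
    noCommonNeighbour⇒twoPrivateNeighbours {v} {b} noTriangle
      with neighbour-avoiding δ≥3 v b b
    ... | c , v~c , c≢b , _ with neighbour-avoiding δ≥3 v b c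
    ... | d , v~d , d≢b , d≢c =
      c , d , ≢-sym d≢c , (v~c , c≢b , λ b~c → noTriangle (c , v~c , sym G b~c))
                        , (v~d , d≢b , λ b~d → noTriangle (d , v~d , sym G b~d))

    triangleFreeEdge⇒spreadEdge : ∀ {v b} → TriangleFreeEdge v b → SpreadEdge v b
    triangleFreeEdge⇒spreadEdge (v~b , noTriangle) =
      v~b , noCommonNeighbour⇒twoPrivateNeighbours noTriangle
          , noCommonNeighbour⇒twoPrivateNeighbours
              (λ (w , b~w , w~v) → noTriangle (w , sym G w~v , sym G b~w))

  module _ (unique : UniqueCommonNeighbours) where

    privateNeighbours-nonadjacent : ∀ {v b c c'} → v ~ b →
                                    PrivateNeighbour v b c → PrivateNeighbour b v c' → ¬ c ~ c'
    privateNeighbours-nonadjacent v~b (v~c , c≢b , _) (b~c' , c'≢v , _) c~c' =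
      c≢b (≡.sym (unique (≢-sym c'≢v) (v~b , b~c') (v~c , c~c')))

    module _ (withinTwo : ∀ u v → WithinDistanceTwo u v) where

      bridge : ∀ {v b c c'} → v ~ b → PrivateNeighbour v b c → PrivateNeighbour b v c' →
               ∃ (CommonNeighbour c c')
      bridge {c = c} {c'} v~b pc@(v~c , _) pc'@(_ , _ , v≁c') with withinTwo c c'
      ... | inj₁ refl        = ⊥-elim (v≁c' v~c)
      ... | inj₂ (inj₁ c~c') = ⊥-elim (privateNeighbours-nonadjacent v~b pc pc' c~c')
      ... | inj₂ (inj₂ y)    = y

      bridge-avoids : ∀ {v b c c' d d' y} → v ~ b →
                      PrivateNeighbour v b c → PrivateNeighbour b v c' →
                      PrivateNeighbour v b d → PrivateNeighbour b v d' → CommonNeighbour c c' y →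
                      y ≢ v × y ≢ b × y ≢ d × y ≢ d'
      bridge-avoids v~b pc@(_ , _ , b≁c) pc'@(_ , _ , v≁c') pd pd' (c~y , y~c') =
          (λ { refl → v≁c' y~c' })
        , (λ { refl → b≁c (sym G c~y) })
        , (λ { refl → privateNeighbours-nonadjacent v~b pd pc' y~c' })
        , (λ { refl → privateNeighbours-nonadjacent v~b pc pd' c~y })

      spreadEdge⇒cycle8 : ∀ {v b} → SpreadEdge v b → HasCycle G 8
      spreadEdge⇒cycle8 {v} {b}
        (v~b , (c , d , c≢d , pc@(v~c , c≢b , _) , pd@(v~d , d≢b , _))
             , (b₁ , b₂ , b₁≢b₂ , pb₁@(b~b₁ , b₁≢v , v≁b₁) , pb₂@(b~b₂ , b₂≢v , v≁b₂)))
        with bridge v~b pc pb₁ | bridge v~b pd pb₂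
      ... | y , cn-y@(c~y , y~b₁) | z , cn-z@(d~z , z~b₂)
        with bridge-avoids v~b pc pb₁ pd pb₂ cn-y | bridge-avoids v~b pd pb₂ pc pb₁ cn-z
      ... | y≢v , y≢b , y≢d , y≢b₂ | z≢v , z≢b , z≢c , z≢b₁ =
        closedWalk⇒cycle (v ∷ c ∷ y ∷ b₁ ∷ b ∷ b₂ ∷ z ∷ d ∷ []) distinct
          (v~c ∷ c~y ∷ y~b₁ ∷ sym G b~b₁ ∷ b~b₂ ∷ sym G z~b₂ ∷ sym G d~z ∷ [-]) (sym G v~d)
        where
        y≢z : y ≢ z
        y≢z refl = y≢v (≡.sym (unique c≢d (sym G v~c , v~d) (c~y , sym G d~z)))

        distinct : Unique (v ∷ c ∷ y ∷ b₁ ∷ b ∷ b₂ ∷ z ∷ d ∷ [])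
        distinct =
            (~⇒≢ v~c ∷ ≢-sym y≢v ∷ ≢-sym b₁≢v ∷ ~⇒≢ v~b ∷ ≢-sym b₂≢v ∷ ≢-sym z≢v ∷ ~⇒≢ v~d ∷ [])
          ∷ (~⇒≢ c~y ∷ ~∧≁⇒≢ v~c v≁b₁ ∷ c≢b ∷ ~∧≁⇒≢ v~c v≁b₂ ∷ ≢-sym z≢c ∷ c≢d ∷ [])
          ∷ (~⇒≢ y~b₁ ∷ y≢b ∷ y≢b₂ ∷ y≢z ∷ y≢d ∷ [])
          ∷ (≢-sym (~⇒≢ b~b₁) ∷ b₁≢b₂ ∷ ≢-sym z≢b₁ ∷ ≢-sym (~∧≁⇒≢ v~d v≁b₁) ∷ [])
          ∷ (~⇒≢ b~b₂ ∷ ≢-sym z≢b ∷ ≢-sym d≢b ∷ [])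
          ∷ (≢-sym (~⇒≢ z~b₂) ∷ ≢-sym (~∧≁⇒≢ v~d v≁b₂) ∷ [])
          ∷ (≢-sym (~⇒≢ d~z) ∷ [])
          ∷ [] ∷ []

  module _ (δ≥3 : MinDegreeAtLeast G 3) (unique : UniqueCommonNeighbours) where

    privateNeighbour-off-triangle : ∀ {v x w u} → v ~ x → CommonNeighbour v x w →
                                    v ~ u → u ≢ x → u ≢ w → PrivateNeighbour v x u
    privateNeighbour-off-triangle v~x cn-w v~u u≢x u≢w =
      v~u , u≢x , λ x~u → u≢w (≡.sym (unique (~⇒≢ v~x) cn-w (v~u , sym G x~u)))

    twoPrivateNeighbours⊎triangleFree : ∀ {v x w} → v ~ x → CommonNeighbour v x w →
                                        TwoPrivateNeighbours v x ⊎ ∃ (TriangleFreeEdge v)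
    twoPrivateNeighbours⊎triangleFree {v} {x} {w} v~x cn-w@(v~w , w~x)
      with neighbour-avoiding δ≥3 v x w
    ... | r , v~r , r≢x , r≢w
      with any? (λ q → adj? G v q ×-dec ¬? (q ≟ x) ×-dec ¬? (q ≟ w) ×-dec ¬? (q ≟ r))
    ... | yes (q , v~q , q≢x , q≢w , q≢r) =
      inj₁ (r , q , ≢-sym q≢r , privateNeighbour-off-triangle v~x cn-w v~r r≢x r≢w
                              , privateNeighbour-off-triangle v~x cn-w v~q q≢x q≢w)
    ... | no noFourth = inj₂ (r , v~r , noTriangle)
      where
      noTriangle : ¬ ∃ (CommonNeighbour v r)
      noTriangle (q , v~q , q~r) with q ≟ x | q ≟ w
      ... | yes refl | _        = r≢w (≡.sym (unique (~⇒≢ v~x) cn-w (v~r , sym G q~r)))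
      ... | no _     | yes refl = r≢x (unique (~⇒≢ v~w) (v~r , sym G q~r) (v~x , sym G w~x))
      ... | no q≢x   | no q≢w   = noFourth (q , v~q , q≢x , q≢w , ~⇒≢ q~r)

    spreadEdge-exists : Fin n → ∃₂ SpreadEdge
    spreadEdge-exists v with neighbour-avoiding δ≥3 v v v
    ... | x , v~x , _ with any? (λ w → adj? G v w ×-dec adj? G w x)
    ... | no noTriangle = v , x , triangleFreeEdge⇒spreadEdge δ≥3 (v~x , noTriangle)
    ... | yes (w , v~w , w~x)
      with twoPrivateNeighbours⊎triangleFree v~x (v~w , w~x)
         | twoPrivateNeighbours⊎triangleFree (sym G v~x) (sym G w~x , sym G v~w)
    ... | inj₂ (r , vr)  | _              = v , r , triangleFreeEdge⇒spreadEdge δ≥3 vr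
    ... | inj₁ _         | inj₂ (r , xr)  = x , r , triangleFreeEdge⇒spreadEdge δ≥3 xr
    ... | inj₁ private-v | inj₁ private-x = v , x , v~x , private-v , private-x

mainTheorem1 : ∀ {n : ℕ} (G : Graph n) →
    HasDiameter G 2 → MinDegreeAtLeast G 3 →
    HasCycle G 4 ⊎ HasCycle G 8
mainTheorem1 G diameter@(_ , v , _) δ≥3 with cycle4⊎uniqueCommonNeighbours G
... | inj₁ cycle4 = inj₁ cycle4
... | inj₂ unique with spreadEdge-exists G δ≥3 unique v
... | _ , _ , spread =
  inj₂ (spreadEdge⇒cycle8 G unique (diameter2⇒withinDistanceTwo G diameter) spread)
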